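{- Let $\Phi,\Psi$ be bouquets with $\Phi\models\Psi$. Then for every context $\Xi$: if $\Xi$ is positive then $\Xi\{\Phi\}\models\Xi\{\Psi\}$, and if $\Xi$ is negative then $\Xi\{\Psi\}\models\Xi\{\Phi\}$.
   Context: Fix a countable set $\mathcal{V}$ of variables and a first-order signature: a countable set $\mathcal{P}$ of predicate symbols with arities $\mathrm{ar}:\mathcal{P}\to\mathbb{N}$. Flowers and gardens by mutual induction: atoms $p(\vec x)$ ($\vec x\in\mathcal V^{\mathrm{ar}(p)}$) are flowers; if $\mathbf{x}\subset\mathcal{V}$ is finite (a sprinkler) and $\Phi$ a finite multiset of flowers (a bouquet), $\mathbf{x}\cdot\Phi$ is a garden; if $\gamma$ is a garden (pistil) and $\Delta$ a finite multiset of gardens (petals), $\gamma\rhd\Delta$ is a flower, also written $\gamma\rhd\delta_1;\dots;\delta_n$. Comma is multiset union of bouquets. Standing convention: every bouquet considered has pairwise distinct binders (variables in sprinklers) and no variable both bound and free. Contexts: $\Xi::=\Psi,\xi$, $\xi::=\Box\mid(\mathbf x\cdot\Xi\rhd\Delta)\mid(\gamma\rhd\mathbf x\cdot\Xi;\Delta)$ ($\Psi$ a bouquet, $\gamma$ a garden, $\Delta$ a corolla); $\Xi\{\Psi\}$ replaces the hole $\Box$ by bouquet $\Psi$. Inversions: $\mathrm{inv}(\Box)=0$, $\mathrm{inv}(\Psi,\xi)=\mathrm{inv}(\xi)$, $\mathrm{inv}(\mathbf x\cdot\Xi\rhd\Delta)=1+\mathrm{inv}(\Xi)$, $\mathrm{inv}(\gamma\rhd\mathbf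 x\cdot\Xi;\Delta)=\mathrm{inv}(\Xi)$; $\Xi$ is positive if $\mathrm{inv}(\Xi)$ is even, negative otherwise. Semantics: $f[R\mapsto g]$ equals $g$ on $R$ and $f$ elsewhere. A Kripke structure $(W,\le,(M_w)_{w\in W})$ has a preorder $\le$ on worlds and for each $w$ a nonempty domain $M_w$ and relations $[\![p]\!]_w\subseteq M_w^{\mathrm{ar}(p)}$, with $M_w\subseteq M_{w'}$ and $[\![p]\!]_w\subseteq[\![p]\!]_{w'}$ when $w\le w'$. A $w$-evaluation is $e:\mathcal V\to M_w$. Forcing: $w\Vdash_e p(x_1,\dots,x_n)$ iff $(e(x_1),\dots,e(x_n))\in[\![p]\!]_w$; $w\Vdash_e\Phi$ iff $w\Vdash_e\phi$ for all $\phi\in\Phi$; $w\Vdash_e(\mathbf x\cdot\Phi\rhd\mathbf x_1\cdot\Phi_1;\dots;\mathbf x_n\cdot\Phi_n)$ iff for every $w'\ge w$ and $w'$-evaluation $e'$ with $w'\Vdash_{e[\mathbf x\mapsto e']}\Phi$, there are $i$ and a $w'$-evaluation $e''$ with $w'\Vdash_{e[\mathbf x\mapsto e'][\mathbf x_i\mapsto e'']}\Phi_i$. $\Phi\models\Psi$ means that in every Kripke structure, at every world $w$ and $w$-evaluation $e$, $w\Vdash_e\Phi$ implies $w\Vdash_e\Psi$. -}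

module Defs where

open import Level using (Level; _⊔_) renaming (suc to lsuc)
open import Data.Nat using (ℕ; zero; suc; _%_; _≟_)
open import Data.List using (List; []; _∷_; _++_; filter)
open import Data.Vec using (Vec; toList) renaming (map to vmap)
open import Data.Product using (Σ; _×_)
open import Data.Sum using (_⊎_)
open import Data.Unit.Polymorphic using (⊤)
open import Data.Empty.Polymorphic using (⊥)
open import Data.Bool using (if_then_else_)
open import Relation.Nullary using (¬_; ¬?; does)
open import Relation.Binary.PropositionalEquality using (_≡_)
open import Data.List.Membership.DecPropositional _≟_ using (_∈?_; _∈_; _∉_)
open import Data.List.Relation.Unary.Unique.Propositional using (Unique)

-- Variables 𝒱 = ℕ; predicate symbols 𝒫 = ℕ (a countable set), with an
-- arbitrary arity function ar : ℕ → ℕ (the signature).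
Var : Set
Var = ℕ

-- A sprinkler (finite set of variables) is represented by a list.
Sprinkler : Set
Sprinkler = List Var

module Syntax (ar : ℕ → ℕ) where

  mutual
    -- Flowers; bouquets (finite multisets of flowers) are lists.
    data Flower : Set where
      atom : (p : ℕ) → Vec Var (ar p) → Flower
      _▷_  : Garden → List Garden → Flower

    data Garden : Set where
      _·_ : Sprinkler → List Flower → Garden

  Bouquet : Set
  Bouquet = List Flower

  Corolla : Set
  Corolla = List Garden

  _minus_ : List Var → List Var → List Var
  vs minus xs = filter (λ v → ¬? (v ∈? xs)) vs

  mutual
    bindersF : Flower → List Var
    bindersF (atom p xs) = []
    bindersF (γ ▷ Δ) = bindersG γ ++ bindersC Δ

    bindersG : Garden → List Var
    bindersG (x · Φ) = x ++ bindersB Φ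

    bindersB : Bouquet → List Var
    bindersB [] = []
    bindersB (φ ∷ Φ) = bindersF φ ++ bindersB Φ

    bindersC : Corolla → List Var
    bindersC [] = []
    bindersC (δ ∷ Δ) = bindersG δ ++ bindersC Δ

  mutual
    fvF : Flower → List Var
    fvF (atom p xs) = toList xs
    fvF ((x · Φ) ▷ Δ) = fvG (x · Φ) ++ (fvC Δ minus x)

    fvG : Garden → List Var
    fvG (x · Φ) = fvB Φ minus x

    fvB : Bouquet → List Var
    fvB [] = []
    fvB (φ ∷ Φ) = fvF φ ++ fvB Φ

    fvC : Corolla → List Var
    fvC [] = []
    fvC (δ ∷ Δ) = fvG δ ++ fvC Δ

  WellFormed : Bouquet → Set
  WellFormed Φ = Unique (bindersB Φ) × (∀ v → v ∈ bindersB Φ → v ∉ fvB Φ)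

  -- Contexts  Ξ ::= Ψ , ξ     ξ ::= □ | (x · Ξ ▷ Δ) | (γ ▷ x · Ξ ; Δ)

  mutual
    data Ctx : Set where
      _,_ : Bouquet → Ctx′ → Ctx

    data Ctx′ : Set where
      □     : Ctx′
      pist  : Sprinkler → Ctx → Corolla → Ctx′
      petal : Garden → Sprinkler → Ctx → Corolla → Ctx′

  mutual
    plug : Ctx → Bouquet → Bouquet
    plug (Ψ′ , ξ) Ψ = Ψ′ ++ plug′ ξ Ψ

    plug′ : Ctx′ → Bouquet → Bouquet
    plug′ □ Ψ = Ψ
    plug′ (pist x Ξ Δ) Ψ = ((x · plug Ξ Ψ) ▷ Δ) ∷ []
    plug′ (petal γ x Ξ Δ) Ψ = (γ ▷ ((x · plug Ξ Ψ) ∷ Δ)) ∷ []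

  mutual
    inv : Ctx → ℕ
    inv (Ψ , ξ) = inv′ ξ

    inv′ : Ctx′ → ℕ
    inv′ □ = 0
    inv′ (pist x Ξ Δ) = suc (inv Ξ)
    inv′ (petal γ x Ξ Δ) = inv Ξ

  Positive : Ctx → Set
  Positive Ξ = inv Ξ % 2 ≡ 0

  Negative : Ctx → Set
  Negative Ξ = inv Ξ % 2 ≡ 1

  _[_↦_] : ∀ {a} {A : Set a} → (Var → A) → Sprinkler → (Var → A) → (Var → A)
  (f [ R ↦ g ]) v = if does (v ∈? R) then g v else f v

  -- A Kripke structure. The domain inclusion M_w ⊆ M_w' (for w ≤ w') is
  -- represented by an injective coercion ι, coherent with the preorder and
  -- independent of the proof of w ≤ w'.
  record Kripke (ℓ : Level) : Set (lsuc ℓ) where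
    field
      W       : Set ℓ
      _≤_     : W → W → Set ℓ
      ≤-refl  : ∀ {w} → w ≤ w
      ≤-trans : ∀ {u v w} → u ≤ v → v ≤ w → u ≤ w
      M       : W → Set ℓ
      nonempty : (w : W) → M w
      ⟦_⟧     : (p : ℕ) → (w : W) → Vec (M w) (ar p) → Set ℓ
      ι       : ∀ {w w′} → w ≤ w′ → M w → M w′
      ι-inj   : ∀ {w w′} (h : w ≤ w′) {a b : M w} → ι h a ≡ ι h b → a ≡ b
      ι-irr   : ∀ {w w′} (h h′ : w ≤ w′) (a : M w) → ι h a ≡ ι h′ a
      ι-refl  : ∀ {w} (a : M w) → ι (≤-refl {w}) a ≡ a
      ι-trans : ∀ {u v w} (h : u ≤ v) (h′ : v ≤ w) (a : M u) →
                ι (≤-trans h h′) a ≡ ι h′ (ι h a)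
      ⟦⟧-mono : ∀ p {w w′} (h : w ≤ w′) (as : Vec (M w) (ar p)) →
                ⟦ p ⟧ w as → ⟦ p ⟧ w′ (vmap (ι h) as)

  module Forcing {ℓ} (K : Kripke ℓ) where
    open Kripke K

    Eval : W → Set ℓ
    Eval w = Var → M w

    mutual
      forceF : (w : W) → Eval w → Flower → Set ℓ
      forceF w e (atom p xs) = ⟦ p ⟧ w (vmap e xs)
      forceF w e ((x · Φ) ▷ Δ) =
        ∀ (w′ : W) (h : w ≤ w′) (e′ : Eval w′) →
          forceB w′ ((λ v → ι h (e v)) [ x ↦ e′ ]) Φ →
          forceAny w′ ((λ v → ι h (e v)) [ x ↦ e′ ]) Δ

      forceB : (w : W) → Eval w → Bouquet → Set ℓ
      forceB w e [] = ⊤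
      forceB w e (φ ∷ Φ) = forceF w e φ × forceB w e Φ

      forceAny : (w : W) → Eval w → Corolla → Set ℓ
      forceAny w e [] = ⊥
      forceAny w e ((x · Φ) ∷ Δ) =
        Σ (Eval w) (λ e″ → forceB w (e [ x ↦ e″ ]) Φ) ⊎ forceAny w e Δ

  Entails : (ℓ : Level) → Bouquet → Bouquet → Set (lsuc ℓ)
  Entails ℓ Φ Ψ = (K : Kripke ℓ) → (w : Kripke.W K) → (e : Forcing.Eval K w) →
    Forcing.forceB K w e Φ → Forcing.forceB K w e Ψ

{-# OPTIONS --safe #-}
module Submission where

open import Defs
open import Level using (Level)
open import Data.Nat using (ℕ; zero; suc; _%_)
open import Data.Product using (_×_; _,_; map₂)
open import Data.Sum using (map₁)
open import Data.List using ([]; _∷_; _++_)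
open import Relation.Binary.PropositionalEquality using (_≡_; refl)

-- Replacement holds already inside each Kripke structure, by induction on the
-- context. Juxtaposition with a bouquet and a petal position preserve the
-- direction of implication between forced bouquets; a pistil position reverses
-- it, since the pistil is the hypothesis of the universal quantification that
-- defines the forcing of a flower. These reversals are what inv counts.

[1+n]%2≡0⇒n%2≡1 : ∀ n → suc n % 2 ≡ 0 → n % 2 ≡ 1
[1+n]%2≡0⇒n%2≡1 (suc zero)    _ = refl
[1+n]%2≡0⇒n%2≡1 (suc (suc n)) p = [1+n]%2≡0⇒n%2≡1 n p

[1+n]%2≡1⇒n%2≡0 : ∀ n → suc n % 2 ≡ 1 → n % 2 ≡ 0
[1+n]%2≡1⇒n%2≡0 zero          _ = refl
[1+n]%2≡1⇒n%2≡0 (suc (suc n)) p = [1+n]%2≡1⇒n%2≡0 n p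

module Replacement (ar : ℕ → ℕ) {ℓ : Level} (K : Syntax.Kripke ar ℓ) where
  open Syntax ar
  open Forcing K

  infix 4 _⇛_
  _⇛_ : Bouquet → Bouquet → Set ℓ
  Φ ⇛ Ψ = ∀ w e → forceB w e Φ → forceB w e Ψ

  private variable
    Φ Ψ : Bouquet

  ++-monoʳ-⇛ : ∀ Ψ′ → Φ ⇛ Ψ → Ψ′ ++ Φ ⇛ Ψ′ ++ Ψ
  ++-monoʳ-⇛ []       Φ⇛Ψ                = Φ⇛Ψ
  ++-monoʳ-⇛ (φ ∷ Ψ′) Φ⇛Ψ w e (f , fs) = f , ++-monoʳ-⇛ Ψ′ Φ⇛Ψ w e fs

  pistil-antitone : ∀ x Δ → Φ ⇛ Ψ → ((x · Ψ) ▷ Δ) ∷ [] ⇛ ((x · Φ) ▷ Δ) ∷ []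
  pistil-antitone x Δ Φ⇛Ψ w e (f , _) = (λ w′ h e′ φ → f w′ h e′ (Φ⇛Ψ w′ _ φ)) , _

  petal-monotone : ∀ γ x Δ → Φ ⇛ Ψ → (γ ▷ ((x · Φ) ∷ Δ)) ∷ [] ⇛ (γ ▷ ((x · Ψ) ∷ Δ)) ∷ []
  petal-monotone (y · Γ) x Δ Φ⇛Ψ w e (f , _) =
    (λ w′ h e′ g → map₁ (map₂ (Φ⇛Ψ w′ _)) (f w′ h e′ g)) , _

  mutual
    plug-monotone : ∀ Ξ → Positive Ξ → Φ ⇛ Ψ → plug Ξ Φ ⇛ plug Ξ Ψ
    plug-monotone (Ψ′ , ξ) pos Φ⇛Ψ = ++-monoʳ-⇛ Ψ′ (plug′-monotone ξ pos Φ⇛Ψ)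

    plug-antitone : ∀ Ξ → Negative Ξ → Φ ⇛ Ψ → plug Ξ Ψ ⇛ plug Ξ Φ
    plug-antitone (Ψ′ , ξ) neg Φ⇛Ψ = ++-monoʳ-⇛ Ψ′ (plug′-antitone ξ neg Φ⇛Ψ)

    plug′-monotone : ∀ ξ → inv′ ξ % 2 ≡ 0 → Φ ⇛ Ψ → plug′ ξ Φ ⇛ plug′ ξ Ψ
    plug′-monotone □               _   Φ⇛Ψ = Φ⇛Ψ
    plug′-monotone (pist x Ξ Δ)    pos Φ⇛Ψ =
      pistil-antitone x Δ (plug-antitone Ξ ([1+n]%2≡0⇒n%2≡1 (inv Ξ) pos) Φ⇛Ψ)
    plug′-monotone (petal γ x Ξ Δ) pos Φ⇛Ψ = petal-monotone γ x Δ (plug-monotone Ξ pos Φ⇛Ψ)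

    plug′-antitone : ∀ ξ → inv′ ξ % 2 ≡ 1 → Φ ⇛ Ψ → plug′ ξ Ψ ⇛ plug′ ξ Φ
    plug′-antitone □               ()
    plug′-antitone (pist x Ξ Δ)    neg Φ⇛Ψ =
      pistil-antitone x Δ (plug-monotone Ξ ([1+n]%2≡1⇒n%2≡0 (inv Ξ) neg) Φ⇛Ψ)
    plug′-antitone (petal γ x Ξ Δ) neg Φ⇛Ψ = petal-monotone γ x Δ (plug-antitone Ξ neg Φ⇛Ψ)

-- The standing convention plays no role: replacement holds for all bouquets.
mainTheorem15 : (ar : ℕ → ℕ) (ℓ : Level) →
    let open Syntax ar in
    (Φ Ψ : Bouquet) → WellFormed Φ → WellFormed Ψ → Entails ℓ Φ Ψ →
    (Ξ : Ctx) →
      (Positive Ξ → WellFormed (plug Ξ Φ) → WellFormed (plug Ξ Ψ) →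
        Entails ℓ (plug Ξ Φ) (plug Ξ Ψ))
      × (Negative Ξ → WellFormed (plug Ξ Φ) → WellFormed (plug Ξ Ψ) →
        Entails ℓ (plug Ξ Ψ) (plug Ξ Φ))
mainTheorem15 ar ℓ Φ Ψ _ _ Φ⊨Ψ Ξ =
  (λ pos _ _ K → Replacement.plug-monotone ar K Ξ pos (Φ⊨Ψ K)) ,
  (λ neg _ _ K → Replacement.plug-antitone ar K Ξ neg (Φ⊨Ψ K))
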